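{- Let $m,n$ be positive integers with $m\le n\le \frac{3m}{2}-3$. Then \[ r(F_n,F_m)\ge \frac{3m}{2}+3n-5.\]
   Context: For a positive integer $k$, the fan $F_k$ is the graph consisting of $k$ triangles that share exactly one common vertex (the center), all other vertices being distinct. For graphs $H_1,H_2$, the Ramsey number $r(H_1,H_2)$ is the minimum $N$ such that every red-blue coloring of the edges of the complete graph $K_N$ contains a red copy of $H_1$ or a blue copy of $H_2$. -}

module Defs where

open import Data.Nat using (ℕ; zero; suc; _+_)
open import Data.Fin using (Fin; zero; suc; _↑ˡ_; _↑ʳ_)
open import Data.Bool using (Bool; true; false)
open import Data.Product using (Σ; _×_; _,_)
open import Data.Sum using (_⊎_)
open import Relation.Binary.PropositionalEquality using (_≡_)
open import Function.Definitions using (Injective)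

Graph : ℕ → Set₁
Graph h = Fin h → Fin h → Set

-- A red/blue edge colouring of the complete graph K_N on Fin N.
-- Only the values c u v with u ≢ v are relevant; symmetry is required.
-- red = true, blue = false.
record Colouring (N : ℕ) : Set where
  field
    col  : Fin N → Fin N → Bool
    symm : ∀ u v → col u v ≡ col v u
open Colouring public

HasMonoCopy : ∀ {h N} → Graph h → Colouring N → Bool → Set
HasMonoCopy {h} {N} H c b =
  Σ (Fin h → Fin N) λ φ → Injective _≡_ _≡_ φ × (∀ x y → H x y → col c (φ x) (φ y) ≡ b)

-- The fan F_k: vertex set Fin (1 + (k + k)); vertex zero is the centre,
-- the k triangles are {centre, suc (i ↑ˡ k), suc (k ↑ʳ i)} for i : Fin k.
data FanEdge (k : ℕ) : Fin (suc (k + k)) → Fin (suc (k + k)) → Set where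
  centre-a : (i : Fin k) → FanEdge k zero (suc (i ↑ˡ k))
  centre-b : (i : Fin k) → FanEdge k zero (suc (k ↑ʳ i))
  a-b      : (i : Fin k) → FanEdge k (suc (i ↑ˡ k)) (suc (k ↑ʳ i))

Fan : (k : ℕ) → Graph (suc (k + k))
Fan k = FanEdge k

-- A colouring of K_N is (H₁,H₂)-good if it has no red H₁ and no blue H₂.
-- r(H₁,H₂) > N  iff  some colouring of K_N is good.
GoodColouring : ∀ {h₁ h₂} → Graph h₁ → Graph h₂ → (N : ℕ) → Colouring N → Set
GoodColouring H₁ H₂ N c = (HasMonoCopy H₁ c true → Data.Empty.⊥) × (HasMonoCopy H₂ c false → Data.Empty.⊥)
  where import Data.Empty

-- Blow up a red/blue colouring of K_5 on parts P, A, B, C, D of sizes 2n,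
-- k = m - 1, ⌊k/2⌋, ⌈k/2⌉ and d.  A red F_n needs a centre with 2n + 1 vertices
-- in its closed red neighbourhood, but every closed red neighbourhood is a union
-- of parts of total size at most 2n.  A blue F_m needs m blue triangles through
-- its centre that are disjoint away from it, but through every vertex the blue
-- triangles are all met by a union of parts of total size at most k.  The
-- hypotheses on m, n and N are what is needed to find such a d with
-- N ≤ 2n + 2k + d.
module Submission where

open import Defs
open import Data.Nat using (ℕ; zero; suc; _+_; _*_; _∸_; _≤_; _<_; z≤n; s≤s; ⌊_/2⌋; ⌈_/2⌉)
import Data.Nat.Properties as ℕ
open import Data.Nat.Tactic.RingSolver using (solve-∀; solve)
open import Data.Fin using (Fin; zero; suc; _≟_; splitAt; join; inject≤)
import Data.Fin.Properties as Fin
open import Data.Bool using (Bool; true; false)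
import Data.Bool.Properties as Bool
open import Data.List using (List; []; _∷_; map)
open import Data.Nat.ListAction using (sum)
open import Data.List.Membership.Propositional using (_∈_)
open import Data.List.Membership.DecPropositional (_≟_ {5}) using (_∈?_)
open import Data.List.Relation.Unary.Any using (toSum)
open import Data.Product using (Σ; Σ-syntax; _×_; _,_; proj₁)
import Data.Product as Product
open import Data.Sum using (_⊎_; inj₁; inj₂; [_,_]′)
open import Data.Sum.Properties using (inj₁-injective; inj₂-injective)
open import Function using (_∘_; id)
open import Function.Definitions using (Injective)
open import Relation.Binary.PropositionalEquality
  using (_≡_; refl; sym; trans; cong; subst; module ≡-Reasoning)
open import Relation.Nullary using (¬_)
open import Relation.Nullary.Decidable using (from-yes; _×-dec_; _⊎-dec_; _→-dec_)

open import Algebra.Properties.Monoid.Sum ℕ.+-0-monoid using () renaming (sum to ∑)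

join-injective : ∀ m n → Injective _≡_ _≡_ (join m n)
join-injective m n {s} {t} e = begin
  s                      ≡⟨ sym (Fin.splitAt-join m n s) ⟩
  splitAt m (join m n s) ≡⟨ cong (splitAt m) e ⟩
  splitAt m (join m n t) ≡⟨ Fin.splitAt-join m n t ⟩
  t                      ∎
  where open ≡-Reasoning

record AtMost {A : Set} (Q : A → Set) (s : ℕ) : Set where
  field
    index           : ∀ x → Q x → Fin s
    index-injective : ∀ {x y} (p : Q x) (q : Q y) → index x p ≡ index y q → x ≡ y
open AtMost

module _ {A : Set} {Q : A → Set} where

  AtMost-injection : ∀ {s k} → AtMost Q s →
    (f : Fin k → A) → Injective _≡_ _≡_ f → (∀ i → Q (f i)) → k ≤ s
  AtMost-injection bound f f-injective f-in-Q =
    Fin.injective⇒≤ (λ e → f-injective (index-injective bound (f-in-Q _) (f-in-Q _) e))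

  AtMost-⊆ : ∀ {R : A → Set} {s} → (∀ {x} → Q x → R x) → AtMost R s → AtMost Q s
  AtMost-⊆ Q⊆R bound = record
    { index           = λ x q → index bound x (Q⊆R q)
    ; index-injective = λ p q → index-injective bound (Q⊆R p) (Q⊆R q)
    }

  AtMost-weaken : ∀ {s t} → s ≤ t → AtMost Q s → AtMost Q t
  AtMost-weaken s≤t bound = record
    { index           = λ x q → inject≤ (index bound x q) s≤t
    ; index-injective = λ p q e →
        index-injective bound p q (Fin.inject≤-injective s≤t s≤t _ _ e)
    }

  AtMost-∪ : ∀ {R : A → Set} {s t} → AtMost Q s → AtMost R t → AtMost (λ x → Q x ⊎ R x) (s + t)
  AtMost-∪ {R} {s} {t} boundQ boundR = record
    { index           = λ x p → join s t (index⊎ x p)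
    ; index-injective = λ p q e → index⊎-injective p q (join-injective s t e)
    }
    where
    index⊎ : ∀ x → Q x ⊎ R x → Fin s ⊎ Fin t
    index⊎ x (inj₁ q) = inj₁ (index boundQ x q)
    index⊎ x (inj₂ r) = inj₂ (index boundR x r)

    index⊎-injective : ∀ {x y} (p : Q x ⊎ R x) (q : Q y ⊎ R y) →
      index⊎ x p ≡ index⊎ y q → x ≡ y
    index⊎-injective (inj₁ p) (inj₁ q) e = index-injective boundQ p q (inj₁-injective e)
    index⊎-injective (inj₂ p) (inj₂ q) e = index-injective boundR p q (inj₂-injective e)
    index⊎-injective (inj₁ _) (inj₂ _) ()
    index⊎-injective (inj₂ _) (inj₁ _) ()

AtMost-preimage : ∀ {A B : Set} {Q : A → Set} {s} (f : B → A) →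
  Injective _≡_ _≡_ f → AtMost Q s → AtMost (Q ∘ f) s
AtMost-preimage f f-injective bound = record
  { index           = λ x → index bound (f x)
  ; index-injective = λ p q e → f-injective (index-injective bound p q e)
  }

ClosedNbhd : ∀ {A : Set} → (A → A → Bool) → Bool → A → A → Set
ClosedNbhd colour b u v = v ≡ u ⊎ colour u v ≡ b

Triangle : ∀ {A : Set} → (A → A → Bool) → Bool → A → A → A → Set
Triangle colour b u v w = colour u v ≡ b × colour u w ≡ b × colour v w ≡ b

CoversTriangles : ∀ {A : Set} → (A → A → Bool) → Bool → A → (A → Set) → Set
CoversTriangles colour b u T = ∀ v w → Triangle colour b u v w → T v ⊎ T w

fan-spoke : ∀ k (s : Fin k ⊎ Fin k) → FanEdge k zero (suc (join k k s))
fan-spoke k (inj₁ i) = centre-a i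
fan-spoke k (inj₂ i) = centre-b i

fan-centre-adjacent : ∀ k x → x ≡ zero ⊎ FanEdge k zero x
fan-centre-adjacent k zero    = inj₁ refl
fan-centre-adjacent k (suc y) =
  inj₂ (subst (FanEdge k zero ∘ suc) (Fin.join-splitAt k k y) (fan-spoke k (splitAt k y)))

module _ {N : ℕ} (c : Colouring N) (b : Bool) where

  noMonoFan-of-closedNbhd : ∀ k → (∀ u → AtMost (ClosedNbhd (col c) b u) (k + k)) →
    ¬ HasMonoCopy (Fan k) c b
  noMonoFan-of-closedNbhd k small (φ , φ-injective , mono) =
    ℕ.1+n≰n (AtMost-injection (small (φ zero)) φ φ-injective in-nbhd)
    where
    in-nbhd : ∀ x → ClosedNbhd (col c) b (φ zero) (φ x)
    in-nbhd x with fan-centre-adjacent k x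
    ... | inj₁ refl = inj₁ refl
    ... | inj₂ edge = inj₂ (mono zero x edge)

  -- Every triangle of the fan meets the cover T of its centre, and the triangles
  -- are disjoint outside the centre, so T receives one vertex per triangle.
  noMonoFan-of-triangleCovers : ∀ k →
    (∀ u → Σ[ T ∈ (Fin N → Set) ] CoversTriangles (col c) b u T × AtMost T k) →
    ¬ HasMonoCopy (Fan (suc k)) c b
  noMonoFan-of-triangleCovers k covers (φ , φ-injective , mono)
    with covers (φ zero)
  ... | T , covers-centre , small =
    ℕ.1+n≰n (AtMost-injection small (φ ∘ leaf ∘ chosen) picked-injective chosen-in-T)
    where
    m = suc k

    leaf : Fin m ⊎ Fin m → Fin (suc (m + m))
    leaf = suc ∘ join m m

    triangle : ∀ i → Triangle (col c) b (φ zero) (φ (leaf (inj₁ i))) (φ (leaf (inj₂ i)))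
    triangle i = mono _ _ (centre-a i) , mono _ _ (centre-b i) , mono _ _ (a-b i)

    chosen : Fin m → Fin m ⊎ Fin m
    chosen i = [ (λ _ → inj₁ i) , (λ _ → inj₂ i) ]′ (covers-centre _ _ (triangle i))

    chosen-in-T : ∀ i → T (φ (leaf (chosen i)))
    chosen-in-T i with covers-centre _ _ (triangle i)
    ... | inj₁ t = t
    ... | inj₂ t = t

    triangle-index : Fin m ⊎ Fin m → Fin m
    triangle-index = [ id , id ]′

    triangle-of-chosen : ∀ i → triangle-index (chosen i) ≡ i
    triangle-of-chosen i with covers-centre _ _ (triangle i)
    ... | inj₁ _ = refl
    ... | inj₂ _ = refl

    picked-injective : Injective _≡_ _≡_ (φ ∘ leaf ∘ chosen)
    picked-injective {i} {j} e = begin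
      i                         ≡⟨ sym (triangle-of-chosen i) ⟩
      triangle-index (chosen i) ≡⟨ cong triangle-index chosen-equal ⟩
      triangle-index (chosen j) ≡⟨ triangle-of-chosen j ⟩
      j                         ∎
      where
      open ≡-Reasoning
      chosen-equal : chosen i ≡ chosen j
      chosen-equal = join-injective m m (Fin.suc-injective (φ-injective e))

unflatten : ∀ {q} (size : Fin q → ℕ) → Fin (∑ size) → Σ (Fin q) (Fin ∘ size)
unflatten {suc q} size i =
  [ (zero ,_) , Product.map suc id ∘ unflatten (size ∘ suc) ]′ (splitAt (size zero) i)

flatten : ∀ {q} (size : Fin q → ℕ) → Σ (Fin q) (Fin ∘ size) → Fin (∑ size)
flatten size (zero  , x) = join (size zero) _ (inj₁ x)
flatten size (suc X , x) = join (size zero) _ (inj₂ (flatten (size ∘ suc) (X , x)))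

flatten-unflatten : ∀ {q} (size : Fin q → ℕ) i → flatten size (unflatten size i) ≡ i
flatten-unflatten {suc q} size i =
  trans (flatten-part (splitAt (size zero) i)) (Fin.join-splitAt (size zero) (∑ (size ∘ suc)) i)
  where
  flatten-part : ∀ s → flatten size ([ (zero ,_) , Product.map suc id ∘ unflatten (size ∘ suc) ]′ s)
                       ≡ join (size zero) (∑ (size ∘ suc)) s
  flatten-part (inj₁ x) = refl
  flatten-part (inj₂ j) = cong (join (size zero) _ ∘ inj₂) (flatten-unflatten (size ∘ suc) j)

unflatten-injective : ∀ {q} (size : Fin q → ℕ) → Injective _≡_ _≡_ (unflatten size)
unflatten-injective size {i} {j} e = begin
  i                              ≡⟨ sym (flatten-unflatten size i) ⟩
  flatten size (unflatten size i) ≡⟨ cong (flatten size) e ⟩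
  flatten size (unflatten size j) ≡⟨ flatten-unflatten size j ⟩
  j                              ∎
  where open ≡-Reasoning

module BlowUp {q : ℕ} (colour : Fin q → Fin q → Bool)
              (colour-symmetric : ∀ X Y → colour X Y ≡ colour Y X)
              (size : Fin q → ℕ) where

  Vertex : Set
  Vertex = Σ (Fin q) (Fin ∘ size)

  inPart-atMost : ∀ X → AtMost (λ (v : Vertex) → proj₁ v ≡ X) (size X)
  inPart-atMost X = record
    { index           = λ { (_ , x) refl → x }
    ; index-injective = λ { refl refl refl → refl }
    }

  inParts-atMost : ∀ Ys → AtMost (λ (v : Vertex) → proj₁ v ∈ Ys) (sum (map size Ys))
  inParts-atMost []       = record { index = λ _ → λ () ; index-injective = λ () }
  inParts-atMost (Y ∷ Ys) = AtMost-⊆ toSum (AtMost-∪ (inPart-atMost Y) (inParts-atMost Ys))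

  module _ {N : ℕ} (N≤ : N ≤ ∑ size) where

    embed : Fin N → Vertex
    embed i = unflatten size (inject≤ i N≤)

    embed-injective : Injective _≡_ _≡_ embed
    embed-injective e = Fin.inject≤-injective N≤ N≤ _ _ (unflatten-injective size e)

    part : Fin N → Fin q
    part = proj₁ ∘ embed

    blowUp : Colouring N
    blowUp = record
      { col  = λ u v → colour (part u) (part v)
      ; symm = λ u v → colour-symmetric (part u) (part v)
      }

    closedNbhd-atMost : ∀ b (Ns : Fin q → List (Fin q)) →
      (∀ X Y → ClosedNbhd colour b X Y → Y ∈ Ns X) →
      ∀ u → AtMost (ClosedNbhd (col blowUp) b u) (sum (map size (Ns (part u))))
    closedNbhd-atMost b Ns Ns-closed u =
      AtMost-⊆ in-Ns (AtMost-preimage embed embed-injective (inParts-atMost (Ns (part u))))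
      where
      in-Ns : ∀ {v} → ClosedNbhd (col blowUp) b u v → part v ∈ Ns (part u)
      in-Ns (inj₁ v≡u) = Ns-closed _ _ (inj₁ (cong part v≡u))
      in-Ns (inj₂ e)   = Ns-closed _ _ (inj₂ e)

  blowUp-good : ∀ {N} n k → N ≤ ∑ size →
    (Ns : Fin q → List (Fin q)) → (∀ X Y → ClosedNbhd colour true X Y → Y ∈ Ns X) →
    (∀ X → sum (map size (Ns X)) ≤ n + n) →
    (Ts : Fin q → List (Fin q)) → (∀ X Y Z → Triangle colour false X Y Z → Y ∈ Ts X ⊎ Z ∈ Ts X) →
    (∀ X → sum (map size (Ts X)) ≤ k) →
    Σ (Colouring N) (GoodColouring (Fan n) (Fan (suc k)) N)
  blowUp-good {N} n k N≤ Ns Ns-closed Ns-small Ts Ts-cover Ts-small =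
      blowUp N≤
    , noMonoFan-of-closedNbhd (blowUp N≤) true n no-red
    , noMonoFan-of-triangleCovers (blowUp N≤) false k no-blue
    where
    no-red : ∀ u → AtMost (ClosedNbhd (col (blowUp N≤)) true u) (n + n)
    no-red u = AtMost-weaken (Ns-small _) (closedNbhd-atMost N≤ true Ns Ns-closed u)

    no-blue : ∀ u → Σ[ T ∈ (Fin N → Set) ] CoversTriangles (col (blowUp N≤)) false u T × AtMost T k
    no-blue u =
        (λ v → part N≤ v ∈ Ts (part N≤ u))
      , (λ v w → Ts-cover _ _ _)
      , AtMost-weaken (Ts-small _) (AtMost-preimage (embed N≤) (embed-injective N≤) (inParts-atMost _))

Part : Set
Part = Fin 5

pattern P = zero
pattern A = suc zero
pattern B = suc (suc zero)
pattern C = suc (suc (suc zero))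
pattern D = suc (suc (suc (suc zero)))

-- Every part is a red clique, P is joined to the other parts in blue, and
-- among A, B, C, D the red pairs form the 4-cycle A B C D; so the blue
-- triangles of parts are exactly P A C and P B D.
red : Part → Part → Bool
red P P = true
red P _ = false
red _ P = false
red A C = false
red C A = false
red B D = false
red D B = false
red _ _ = true

redNbhd : Part → List Part
redNbhd P = P ∷ []
redNbhd A = A ∷ B ∷ D ∷ []
redNbhd B = A ∷ B ∷ C ∷ []
redNbhd C = B ∷ C ∷ D ∷ []
redNbhd D = A ∷ C ∷ D ∷ []

blueCover : Part → List Part
blueCover P = B ∷ C ∷ []
blueCover A = C ∷ []
blueCover B = D ∷ []
blueCover C = A ∷ []
blueCover D = B ∷ []

red-symmetric : ∀ X Y → red X Y ≡ red Y X
red-symmetric = from-yes (Fin.all? λ (X : Part) → Fin.all? λ (Y : Part) → red X Y Bool.≟ red Y X)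

redNbhd-closed : ∀ X Y → ClosedNbhd red true X Y → Y ∈ redNbhd X
redNbhd-closed = from-yes (Fin.all? λ (X : Part) → Fin.all? λ (Y : Part) →
  ((Y ≟ X) ⊎-dec (red X Y Bool.≟ true)) →-dec (Y ∈? redNbhd X))

blueCover-covers : ∀ X Y Z → Triangle red false X Y Z → Y ∈ blueCover X ⊎ Z ∈ blueCover X
blueCover-covers = from-yes (Fin.all? λ (X : Part) → Fin.all? λ (Y : Part) → Fin.all? λ (Z : Part) →
  ((red X Y Bool.≟ false) ×-dec (red X Z Bool.≟ false) ×-dec (red Y Z Bool.≟ false))
    →-dec ((Y ∈? blueCover X) ⊎-dec (Z ∈? blueCover X)))

fiveParts-good : ∀ {N} n k b c d → b + c ≡ k → b ≤ c → k ≤ n → d ≤ k →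
  k + (c + d) ≤ n + n → N ≤ n + n + (k + k) + d →
  Σ (Colouring N) (GoodColouring (Fan n) (Fan (suc k)) N)
fiveParts-good {N} n k b c d b+c≡k b≤c k≤n d≤k D-small N≤ =
  BlowUp.blowUp-good red red-symmetric size n k N≤∑
    redNbhd redNbhd-closed redNbhd-small blueCover blueCover-covers blueCover-small
  where
  size : Part → ℕ
  size P = n + n
  size A = k
  size B = b
  size C = c
  size D = d

  c≤k : c ≤ k
  c≤k = subst (c ≤_) b+c≡k (ℕ.m≤n+m c b)

  b≤k : b ≤ k
  b≤k = ℕ.≤-trans b≤c c≤k

  N≤∑ : N ≤ ∑ size
  N≤∑ = subst (N ≤_) total N≤
    where
    total : n + n + (k + k) + d ≡ n + n + (k + (b + (c + (d + 0))))
    total rewrite ℕ.+-identityʳ d | sym b+c≡k = solve (n ∷ b ∷ c ∷ d ∷ [])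

  redNbhd-small : ∀ X → sum (map size (redNbhd X)) ≤ n + n
  redNbhd-small P = ℕ.≤-reflexive (ℕ.+-identityʳ (n + n))
  redNbhd-small A rewrite ℕ.+-identityʳ d = ℕ.≤-trans (ℕ.+-monoʳ-≤ k (ℕ.+-monoˡ-≤ d b≤c)) D-small
  redNbhd-small B rewrite ℕ.+-identityʳ c | b+c≡k = ℕ.+-mono-≤ k≤n k≤n
  redNbhd-small C rewrite ℕ.+-identityʳ d = ℕ.≤-trans (ℕ.+-monoˡ-≤ (c + d) b≤k) D-small
  redNbhd-small D rewrite ℕ.+-identityʳ d = D-small

  blueCover-small : ∀ X → sum (map size (blueCover X)) ≤ k
  blueCover-small P rewrite ℕ.+-identityʳ c = ℕ.≤-reflexive b+c≡k
  blueCover-small A rewrite ℕ.+-identityʳ c = c≤k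
  blueCover-small B rewrite ℕ.+-identityʳ d = d≤k
  blueCover-small C rewrite ℕ.+-identityʳ k = ℕ.≤-refl
  blueCover-small D rewrite ℕ.+-identityʳ b = b≤k

⌈n/2⌉+⌈n/2⌉≤1+n : ∀ n → ⌈ n /2⌉ + ⌈ n /2⌉ ≤ suc n
⌈n/2⌉+⌈n/2⌉≤1+n zero          = z≤n
⌈n/2⌉+⌈n/2⌉≤1+n (suc zero)    = s≤s (s≤s z≤n)
⌈n/2⌉+⌈n/2⌉≤1+n (suc (suc n)) rewrite ℕ.+-suc ⌈ n /2⌉ ⌈ n /2⌉ = s≤s (s≤s (⌈n/2⌉+⌈n/2⌉≤1+n n))

≤-by-cancelling : ∀ {x y} s t {L R} → L ≤ R → L ≡ x + s + t → R ≡ y + t → x ≤ y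
≤-by-cancelling {x} {y} s t L≤R refl refl =
  ℕ.≤-trans (ℕ.m≤m+n x s) (ℕ.+-cancelʳ-≤ t (x + s) y L≤R)

m+o≤n+p∧o≤p⇒m≤n+[p∸o] : ∀ {m n o p} → m + o ≤ n + p → o ≤ p → m ≤ n + (p ∸ o)
m+o≤n+p∧o≤p⇒m≤n+[p∸o] {m} {n} {o} {p} m+o≤n+p o≤p = ℕ.+-cancelʳ-≤ o m (n + (p ∸ o))
  (subst (m + o ≤_) (trans (cong (n +_) (sym (ℕ.m∸n+n≡m o≤p))) (sym (ℕ.+-assoc n (p ∸ o) o))) m+o≤n+p)

-- The part D receives the N ∸ (2n + 2k) vertices that do not fit into P, A, B, C.
excess-bounds : ∀ {n k N} → suc k ≤ n → 2 * n + 6 ≤ 3 * suc k → 2 * N + 10 < 3 * suc k + 6 * n →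
  let d = N ∸ (n + n + (k + k)) in d ≤ k × k + (⌈ k /2⌉ + d) ≤ n + n
excess-bounds {n} {k} {N} k<n 2n+6≤3m 2N+10<3m+6n = d≤k , D-small
  where
  X₀ = n + n + (k + k)
  c = ⌈ k /2⌉
  k≤n = ℕ.<⇒≤ k<n

  N≤X₀+k : N ≤ X₀ + k
  N≤X₀+k = ℕ.*-cancelˡ-≤ 2 (≤-by-cancelling 11 (2 * n + 6)
    (ℕ.+-mono-≤ 2N+10<3m+6n 2n+6≤3m) (lhs n N) (rhs n k))
    where
    lhs : ∀ n N → suc (2 * N + 10) + (2 * n + 6) ≡ 2 * N + 11 + (2 * n + 6)
    lhs = solve-∀
    rhs : ∀ n k → 3 * suc k + 6 * n + 3 * suc k ≡ 2 * (n + n + (k + k) + k) + (2 * n + 6)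
    rhs = solve-∀

  N+k+c≤X₀+2n : N + (k + c) ≤ X₀ + (n + n)
  N+k+c≤X₀+2n = ℕ.*-cancelˡ-≤ 2 (≤-by-cancelling 9 4
    (ℕ.+-mono-≤ (ℕ.+-mono-≤ 2N+10<3m+6n (⌈n/2⌉+⌈n/2⌉≤1+n k)) (ℕ.+-mono-≤ k<n k<n))
    (lhs k N c) (rhs n k))
    where
    lhs : ∀ k N c → suc (2 * N + 10) + (c + c) + (suc k + suc k) ≡ 2 * (N + (k + c)) + 9 + 4
    lhs = solve-∀
    rhs : ∀ n k → 3 * suc k + 6 * n + suc k + (n + n) ≡ 2 * (n + n + (k + k) + (n + n)) + 4
    rhs = solve-∀

  k+c≤2n : k + c ≤ n + n
  k+c≤2n = ℕ.+-mono-≤ k≤n (ℕ.≤-trans (ℕ.⌈n/2⌉≤n k) k≤n)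

  d≤k : N ∸ X₀ ≤ k
  d≤k = ℕ.m≤n+o⇒m∸n≤o N X₀ N≤X₀+k

  D-small : k + (c + (N ∸ X₀)) ≤ n + n
  D-small = begin
    k + (c + (N ∸ X₀))         ≡⟨ ℕ.+-assoc k c (N ∸ X₀) ⟨
    k + c + (N ∸ X₀)           ≤⟨ ℕ.+-monoʳ-≤ (k + c) (ℕ.m≤n+o⇒m∸n≤o N X₀
                                    (m+o≤n+p∧o≤p⇒m≤n+[p∸o] N+k+c≤X₀+2n k+c≤2n)) ⟩
    k + c + ((n + n) ∸ (k + c)) ≡⟨ ℕ.m+[n∸m]≡n k+c≤2n ⟩
    n + n                      ∎
    where open ℕ.≤-Reasoning

theorem9 : (m n : ℕ) → 1 ≤ m → 1 ≤ n → m ≤ n → 2 * n + 6 ≤ 3 * m →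
    (N : ℕ) → 2 * N + 10 < 3 * m + 6 * n →
      Σ (Colouring N) (GoodColouring (Fan n) (Fan m) N)
theorem9 zero    n () _ _ _ _ _
theorem9 (suc k) n _ _ k<n 2n+6≤3m N 2N+10<3m+6n
  with excess-bounds {N = N} k<n 2n+6≤3m 2N+10<3m+6n
... | d≤k , D-small =
  fiveParts-good n k ⌊ k /2⌋ ⌈ k /2⌉ (N ∸ (n + n + (k + k)))
    (ℕ.⌊n/2⌋+⌈n/2⌉≡n k) (ℕ.⌊n/2⌋≤⌈n/2⌉ k) (ℕ.<⇒≤ k<n) d≤k D-small
    (ℕ.m≤n+m∸n N (n + n + (k + k)))
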